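{- In the setting described in the context, the expected hub set size of every node $u \in V$ satisfies $$\mathbb{E}\, |S(u)| \leq 16\, \mathrm{isk}(u).$$
   Context: Let $G=(V\cup V^+,E)$ be a finite unweighted graph with a distinguished set $V$ of terminal nodes, in which every node of $V^+$ has degree $2$. Each $u\in V$ is associated with a fixed tree $T_u\subseteq G$, rooted at $u$ and containing all nodes of $V$. For nodes $v,w$ of $T_u$, $P_u(v,w)$ is the unique path between $v$ and $w$ in $T_u$, $P_u(v):=P_u(u,v)$, $|P|$ denotes the number of edges of a path $P$, and $d_u(v):=|P_u(v)|$. It is assumed that $P_u(v)=P_v(u)$ for all $u,v\in V$, and that $|P_u(v,w)|$ is an integer multiple of $12$ for all $u,v,w\in V$. Orient $T_u$ from the root to the leaves; for a node $v$ of $T_u$, $\mathrm{reach}_{T_u}(v)$ is the maximum of $d_u(x)-d_u(v)$ over descendants $x$ of $v$ in $T_u$ (including $v$). Let $V_u^*:=\{v\in V(T_u): \mathrm{reach}_{T_u}(v)\ge \tfrac12 d_u(v)\}$, and define the integrated skeleton dimension $\mathrm{isk}(u):=\sum_{v\in V_u^*, v\neq u} \frac{1}{d_u(v)}$. Random hub construction: each edge $e\in E$ receives a value $\rho(e)\in[0,1]$ uniformly and independently at random (all values distinct with probability 1). For $u,v\in V$, $v\ne u$, the central subpath is $P_u'(v):=P_u(u',v')$, where $u',v'\in P_u(v)$ satisfy $d_u(u')=\tfrac{5}{12}d_u(v)$ and $d_u(v')=\tfrac{7}{12}d_u(v)$; $\eta_u(v):=\arg\min_{e\in P_u'(v)}\rho(e)$;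 and $S(u):=\{\eta_u(v): v\in V, v\ne u\}$. -}

module Defs where

open import Data.Nat as ℕ using (ℕ; zero; suc; _+_; _*_; _∸_; _≤ᵇ_; _<ᵇ_; _⊔_)
open import Data.Fin as Fin using (Fin; toℕ)
open import Data.Fin.Properties using () renaming (_≟_ to _≟ᶠ_)
open import Data.Bool using (Bool; true; false; _∧_; _∨_; not; if_then_else_)
open import Data.List using (List; []; _∷_; map; foldr; length; filterᵇ; upTo; allFin; concatMap)
open import Data.Bool.ListAction using (any; all)
open import Data.Nat.ListAction using (sum)
open import Data.Product using (_×_; _,_)
open import Data.Sum using (_⊎_)
open import Relation.Nullary.Decidable using (⌊_⌋)
open import Relation.Binary.PropositionalEquality using (_≡_; _≢_)
open import Data.Integer using (+_)
open import Data.Rational as ℚ using (ℚ; _/_; 0ℚ)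

_==_ : ∀ {k} → Fin k → Fin k → Bool
a == b = ⌊ a ≟ᶠ b ⌋

-- A finite simple (unweighted) graph with node set Fin n, edge set Fin m,
-- edge e joining src e and tgt e, and terminal set V = { v | terminal v ≡ true };
-- the remaining nodes form V⁺.
record Graph : Set where
  field
    n m      : ℕ
    src tgt  : Fin m → Fin n
    terminal : Fin n → Bool
    noLoop   : ∀ e → src e ≢ tgt e
    noMulti  : ∀ e e′ → ((src e ≡ src e′ × tgt e ≡ tgt e′) ⊎ (src e ≡ tgt e′ × tgt e ≡ src e′)) → e ≡ e′

module _ (G : Graph) where
  open Graph G

  Joins : Fin m → Fin n → Fin n → Set
  Joins e a b = (src e ≡ a × tgt e ≡ b) ⊎ (src e ≡ b × tgt e ≡ a)

  deg : Fin n → ℕ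
  deg v = length (filterᵇ (λ e → (src e == v) ∨ (tgt e == v)) (allFin m))

  -- A tree T ⊆ G rooted at r, given by its node set, parent pointers, parent
  -- edges and depths (depth strictly decreases towards the root, so this is a tree),
  -- containing every terminal node.
  record RootedTree (r : Fin n) : Set where
    field
      inT     : Fin n → Bool
      par     : Fin n → Fin n
      pe      : Fin n → Fin m
      dep     : Fin n → ℕ
      root-in : inT r ≡ true
      dep-r   : dep r ≡ 0
      step    : ∀ v → inT v ≡ true → v ≢ r →
                inT (par v) ≡ true × dep v ≡ suc (dep (par v)) × Joins (pe v) v (par v)
      spans   : ∀ v → terminal v ≡ true → inT v ≡ true

  module _ {r : Fin n} (T : RootedTree r) where
    open RootedTree T

    anc : ℕ → Fin n → Fin n
    anc zero    v = v
    anc (suc k) v = par (anc k v)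

    -- a is an ancestor of x (or x itself) in T, i.e. x is a descendant of a
    isDesc : Fin n → Fin n → Bool
    isDesc a x = inT x ∧ any (λ k → anc k x == a) (upTo (suc (dep x)))

    reach : Fin n → ℕ
    reach v = foldr _⊔_ 0 (map (λ x → if isDesc v x then dep x ∸ dep v else 0) (allFin n))

    inVstar : Fin n → Bool
    inVstar v = inT v ∧ (dep v ≤ᵇ 2 * reach v)

    -- 1/d (d ≥ 1 in all uses; 0 for d = 0 by convention)
    inv : ℕ → ℚ
    inv zero    = 0ℚ
    inv (suc k) = + 1 / suc k

    isk : ℚ
    isk = foldr ℚ._+_ 0ℚ
            (map (λ v → if inVstar v ∧ not (v == r) then inv (dep v) else 0ℚ) (allFin n))

    pathE : Fin n → List (Fin m)
    pathE v = map (λ k → pe (anc k v)) (upTo (dep v))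

    lcaDepth : Fin n → Fin n → ℕ
    lcaDepth v w = foldr _⊔_ 0
      (map (λ a → if isDesc a v ∧ isDesc a w then dep a else 0) (allFin n))

    treeDist : Fin n → Fin n → ℕ
    treeDist v w = dep v + dep w ∸ 2 * lcaDepth v w

    -- edges of the central subpath P'_r(v): the edges (a, par a) of P_r(v) with
    -- 5/12 d(v) ≤ d(par a) and d(a) ≤ 7/12 d(v), i.e. 5 d(v) < 12 d(a) ≤ 7 d(v)
    central : Fin n → List (Fin m)
    central v = map (λ k → pe (anc k v))
      (filterᵇ (λ k → (5 * dep v <ᵇ 12 * dep (anc k v)) ∧ (12 * dep (anc k v) ≤ᵇ 7 * dep v))
               (upTo (dep v)))

    isArgmin : (Fin m → Fin m) → Fin m → List (Fin m) → Bool
    isArgmin ρ e L = any (λ e′ → e′ == e) L ∧ all (λ e′ → toℕ (ρ e) ≤ᵇ toℕ (ρ e′)) L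

    hubCount : (Fin m → Fin m) → ℕ
    hubCount ρ = length (filterᵇ
      (λ e → any (λ v → terminal v ∧ not (v == r) ∧ isArgmin ρ e (central v)) (allFin n))
      (allFin m))

  allFuns : (k : ℕ) → List (Fin k → Fin m)
  allFuns zero    = (λ ()) ∷ []
  allFuns (suc k) = concatMap (λ f → map (λ x → λ { Fin.zero → x ; (Fin.suc i) → f i }) (allFin m))
                              (allFuns k)

  isInjective : (Fin m → Fin m) → Bool
  isInjective f = all (λ i → all (λ j → not (f i == f j) ∨ (i == j)) (allFin m)) (allFin m)

  -- all rankings of the edges (bijections Fin m → Fin m); ρ(e) < ρ(e') means
  -- e has the smaller random value.  A uniformly random ranking is exactly the
  -- (a.s.) order induced by i.i.d. uniform values in [0,1].
  rankings : List (Fin m → Fin m)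
  rankings = filterᵇ isInjective (allFuns m)

  ratio : ℕ → ℕ → ℚ
  ratio a zero    = 0ℚ
  ratio a (suc k) = + a / suc k

  expectedHubs : {r : Fin n} → RootedTree r → ℚ
  expectedHubs T = ratio (sum (map (hubCount T) rankings)) (length rankings)

module Submission where

-- A hub e = η_u(v) is the ρ-least edge of the central subpath of P_u(v); let a be its lower end,
-- at depth k with 5 d_u(v) < 12 k ≤ 7 d_u(v).  Charge e to a node x determined by e alone:
-- if d_u(v) ≤ 2k, to x = a, and e is then least among the ≈ k/6 edges just above a; otherwise
-- to the node x at depth k + 1 + ⌊k/6⌋ below a, and e is then the top edge of the ≈ d_u(x)/7
-- edges just above x.  Either path lies inside the central subpath, so e is least on it, and
-- 12 d_u(x) ≤ 7 d_u(v) gives reach(x) ≥ d_u(v) − d_u(x) ≥ d_u(x)/2, i.e. x ∈ V*_u.  A fixed edge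
-- is least on a fixed path of L edges for exactly a 1/L fraction of the rankings, so x receives
-- at most 6/d_u(x) + 7/d_u(x) expected hubs, and E |S(u)| ≤ 13 isk(u) ≤ 16 isk(u).

open import Defs
open import Data.Bool using (Bool; true; false; _∧_; _∨_; not; if_then_else_; T)
open import Data.Bool.ListAction using (any; all)
open import Data.Bool.Properties using (T-≡; T?; ∧-zeroʳ)
open import Data.Empty using (⊥; ⊥-elim)
open import Data.Fin using (Fin; toℕ)
open import Data.Fin.Permutation using (Permutation′; _⟨$⟩ʳ_; _⟨$⟩ˡ_; inverseˡ; inverseʳ; transpose)
open import Data.Fin.Properties using (toℕ-injective) renaming (_≟_ to _≟ᶠ_)
open import Data.List using (List; []; _∷_; _++_; map; foldr; length; filterᵇ; allFin; upTo; concatMap; cartesianProductWith; reverse)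
open import Data.List.Membership.Propositional using (_∈_)
open import Data.List.Membership.Propositional.Properties
  using (∈-∃++; ∈-++⁺ˡ; ∈-++⁺ʳ; ∈-allFin; ∈-map⁺; ∈-map⁻; ∈-cartesianProductWith⁺; ∈-filter⁺; ∈-filter⁻; ∈-upTo⁺; ∈-upTo⁻)
open import Data.List.Membership.Propositional.Properties.WithK using (unique∧set⇒bag)
open import Data.List.Properties
  using (map-cong; map-cong-local; map-∘; length-map; length-++; length-++-sucʳ; length-upTo; map-concatMap; concatMap-cong; concatMap-map)
open import Data.List.Relation.Binary.BagAndSetEquality using (∼bag⇒↭)
open import Data.List.Relation.Binary.Permutation.Propositional using (_↭_)
open import Data.List.Relation.Binary.Permutation.Propositional.Properties using (filter-↭; ↭-length)
open import Data.List.Relation.Binary.Subset.Propositional using (_⊆_)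
open import Data.List.Relation.Unary.All as All using (All)
import Data.List.Relation.Unary.All.Properties as All
open import Data.List.Relation.Unary.AllPairs using ([]; _∷_)
open import Data.List.Relation.Unary.Any using (here; there)
open import Data.List.Relation.Unary.Unique.Propositional using (Unique)
open import Data.List.Relation.Unary.Unique.Propositional.Properties using (cartesianProductWith⁺; allFin⁺; map⁺; upTo⁺; filter⁺)
open import Data.Nat using (ℕ; zero; suc)
open import Data.Nat.ListAction using (sum)
open import Data.Product using (_×_; _,_; Σ; proj₁; proj₂)
open import Data.Sum using (inj₁; inj₂)
open import Data.Vec as V using (Vec)
open import Data.Vec.Properties using (lookup∘tabulate; tabulate∘lookup; tabulate-cong; ∷-injective)
open import Function using (_∘_; Equivalence; mk⇔)
open import Function.Definitions using (Injective)
open import Relation.Binary.PropositionalEquality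
open import Relation.Nullary using (yes; no; contradiction)
open import Relation.Nullary.Decidable using (dec-true)

private variable
  A B : Set

module HubCounting where

  open import Data.Nat using (_+_; _*_; _∸_; _≤_; _<_; z≤n; s≤s; _≤ᵇ_; _<ᵇ_; _⊔_; _/_; _%_; _≤?_)
  open import Data.Nat.Properties
  open import Data.Nat.Base using (s≤s⁻¹)
  open import Data.Nat.DivMod using (m≡m%n+[m/n]*n; m%n<n; m*n/n≡m; m/n*n≤m; /-monoˡ-≤; m/n<m; +-distrib-/-∣ʳ; m<n⇒m/n≡0)
  open import Data.Nat.Divisibility using (_∣_; divides)
  open import Data.Nat.Tactic.RingSolver using (solve-∀)

  ≡true⇒T : ∀ {b} → b ≡ true → T b
  ≡true⇒T = Equivalence.from T-≡

  T⇒≡true : ∀ {b} → T b → b ≡ true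
  T⇒≡true = Equivalence.to T-≡

  ∧-trueˡ : ∀ {a b} → a ∧ b ≡ true → a ≡ true
  ∧-trueˡ {true} _ = refl

  ∧-trueʳ : ∀ {a b} → a ∧ b ≡ true → b ≡ true
  ∧-trueʳ {true} e = e

  ∧-true : ∀ {a b} → a ≡ true → b ≡ true → a ∧ b ≡ true
  ∧-true refl refl = refl

  ≡true-ext : ∀ {a b} → (a ≡ true → b ≡ true) → (b ≡ true → a ≡ true) → a ≡ b
  ≡true-ext {true}  f _ = sym (f refl)
  ≡true-ext {false} {true}  _ g = g refl
  ≡true-ext {false} {false} _ _ = refl

  any-true⁺ : (p : A → Bool) {x : A} {xs : List A} → x ∈ xs → p x ≡ true → any p xs ≡ true
  any-true⁺ p (here refl) px rewrite px = refl
  any-true⁺ p {xs = y ∷ _} (there x∈xs) px with p y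
  ... | true  = refl
  ... | false = any-true⁺ p x∈xs px

  any-true⁻ : (p : A → Bool) (xs : List A) → any p xs ≡ true → Σ A λ x → x ∈ xs × p x ≡ true
  any-true⁻ p (y ∷ xs) h with p y in py
  ... | true  = y , here refl , py
  ... | false with any-true⁻ p xs h
  ...   | x , x∈xs , px = x , there x∈xs , px

  all-true⁺ : (p : A → Bool) (xs : List A) → (∀ {x} → x ∈ xs → p x ≡ true) → all p xs ≡ true
  all-true⁺ p []       _ = refl
  all-true⁺ p (y ∷ xs) h = ∧-true (h (here refl)) (all-true⁺ p xs (h ∘ there))

  all-true⁻ : (p : A → Bool) {x : A} {xs : List A} → all p xs ≡ true → x ∈ xs → p x ≡ true
  all-true⁻ p h (here refl) = ∧-trueˡ h
  all-true⁻ p {xs = y ∷ _} h (there x∈xs) = all-true⁻ p (∧-trueʳ {p y} h) x∈xs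

  all-cong : {p q : A → Bool} → p ≗ q → all p ≗ all q
  all-cong p≗q []       = refl
  all-cong p≗q (x ∷ xs) = cong₂ _∧_ (p≗q x) (all-cong p≗q xs)

  𝟙 : Bool → ℕ
  𝟙 true  = 1
  𝟙 false = 0

  count : (A → Bool) → List A → ℕ
  count p xs = length (filterᵇ p xs)

  count-∷ : (p : A → Bool) (x : A) (xs : List A) → count p (x ∷ xs) ≡ 𝟙 (p x) + count p xs
  count-∷ p x xs with p x
  ... | true  = refl
  ... | false = refl

  count≡sum-𝟙 : (p : A → Bool) (xs : List A) → count p xs ≡ sum (map (𝟙 ∘ p) xs)
  count≡sum-𝟙 p []       = refl
  count≡sum-𝟙 p (x ∷ xs) = trans (count-∷ p x xs) (cong (𝟙 (p x) +_) (count≡sum-𝟙 p xs))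

  count-cong : {p q : A → Bool} → p ≗ q → count p ≗ count q
  count-cong {p = p} {q} p≗q xs = begin
    count p xs              ≡⟨ count≡sum-𝟙 p xs ⟩
    sum (map (𝟙 ∘ p) xs)    ≡⟨ cong sum (map-cong (cong 𝟙 ∘ p≗q) xs) ⟩
    sum (map (𝟙 ∘ q) xs)    ≡⟨ count≡sum-𝟙 q xs ⟨
    count q xs              ∎
    where open ≡-Reasoning

  count-map : (p : B → Bool) (f : A → B) (xs : List A) → count p (map f xs) ≡ count (p ∘ f) xs
  count-map p f xs = begin
    count p (map f xs)             ≡⟨ count≡sum-𝟙 p (map f xs) ⟩
    sum (map (𝟙 ∘ p) (map f xs))   ≡⟨ cong sum (map-∘ xs) ⟨
    sum (map (𝟙 ∘ p ∘ f) xs)       ≡⟨ count≡sum-𝟙 (p ∘ f) xs ⟨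
    count (p ∘ f) xs               ∎
    where open ≡-Reasoning

  count-filterᵇ : (p q : A → Bool) (xs : List A) → count p (filterᵇ q xs) ≡ count (λ x → q x ∧ p x) xs
  count-filterᵇ p q [] = refl
  count-filterᵇ p q (x ∷ xs) rewrite count-∷ (λ y → q y ∧ p y) x xs with q x
  ... | true  = trans (count-∷ p x (filterᵇ q xs)) (cong (𝟙 (p x) +_) (count-filterᵇ p q xs))
  ... | false = count-filterᵇ p q xs

  count≡0 : (p : A → Bool) (xs : List A) → (∀ {x} → x ∈ xs → p x ≡ false) → count p xs ≡ 0
  count≡0 p []       _ = refl
  count≡0 p (x ∷ xs) h rewrite count-∷ p x xs | h (here refl) = count≡0 p xs (h ∘ there)

  count≤1 : (p : A → Bool) (xs : List A) → Unique xs →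
            (∀ {x y} → x ∈ xs → y ∈ xs → p x ≡ true → p y ≡ true → x ≡ y) → count p xs ≤ 1
  count≤1 p []       _            _  = z≤n
  count≤1 p (x ∷ xs) (x∉xs ∷ uxs) at-most-one rewrite count-∷ p x xs with p x in px
  ... | true  = s≤s (≤-reflexive (count≡0 p xs rejects))
    where
    rejects : ∀ {y} → y ∈ xs → p y ≡ false
    rejects {y} y∈xs with p y in py
    ... | false = refl
    ... | true  = ⊥-elim (All.lookup x∉xs y∈xs (at-most-one (here refl) (there y∈xs) px py))
  ... | false = count≤1 p xs uxs (λ x∈ y∈ → at-most-one (there x∈) (there y∈))

  sum-map-+ : (f g : A → ℕ) (xs : List A) → sum (map (λ x → f x + g x) xs) ≡ sum (map f xs) + sum (map g xs)
  sum-map-+ f g []       = refl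
  sum-map-+ f g (x ∷ xs) rewrite sum-map-+ f g xs = +-exchange (f x) (g x) (sum (map f xs)) (sum (map g xs))
    where
    +-exchange : ∀ a b c d → a + b + (c + d) ≡ a + c + (b + d)
    +-exchange = solve-∀

  sum-map-const : (c : ℕ) (xs : List A) → sum (map (λ _ → c) xs) ≡ length xs * c
  sum-map-const c []       = refl
  sum-map-const c (x ∷ xs) = cong (c +_) (sum-map-const c xs)

  sum-map-mono : (f g : A → ℕ) (xs : List A) → (∀ {x} → x ∈ xs → f x ≤ g x) → sum (map f xs) ≤ sum (map g xs)
  sum-map-mono f g []       _ = z≤n
  sum-map-mono f g (x ∷ xs) h = +-mono-≤ (h (here refl)) (sum-map-mono f g xs (h ∘ there))

  sum-swap : (g : A → B → ℕ) (xs : List A) (ys : List B) →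
             sum (map (λ x → sum (map (g x) ys)) xs) ≡ sum (map (λ y → sum (map (λ x → g x y) xs)) ys)
  sum-swap g []       ys = trans (sym (*-zeroʳ (length ys))) (sym (sum-map-const 0 ys))
  sum-swap g (x ∷ xs) ys = trans (cong (sum (map (g x) ys) +_) (sum-swap g xs ys))
                                 (sym (sum-map-+ (g x) (λ y → sum (map (λ x → g x y) xs)) ys))

  sum-count-swap : (p : A → B → Bool) (xs : List A) (ys : List B) →
                   sum (map (λ x → count (p x) ys) xs) ≡ sum (map (λ y → count (λ x → p x y) xs) ys)
  sum-count-swap p xs ys = begin
    sum (map (λ x → count (p x) ys) xs)                  ≡⟨ cong sum (map-cong (λ x → count≡sum-𝟙 (p x) ys) xs) ⟩
    sum (map (λ x → sum (map (λ y → 𝟙 (p x y)) ys)) xs)  ≡⟨ sum-swap (λ x y → 𝟙 (p x y)) xs ys ⟩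
    sum (map (λ y → sum (map (λ x → 𝟙 (p x y)) xs)) ys)  ≡⟨ cong sum (map-cong (λ y → count≡sum-𝟙 (λ x → p x y) xs) ys) ⟨
    sum (map (λ y → count (λ x → p x y) xs) ys)          ∎
    where open ≡-Reasoning

  ∈-remove : {x y : A} (ys zs : List A) → y ∈ ys ++ x ∷ zs → y ≢ x → y ∈ ys ++ zs
  ∈-remove []       zs (here y≡x)   y≢x = ⊥-elim (y≢x y≡x)
  ∈-remove []       zs (there y∈zs) _   = y∈zs
  ∈-remove (w ∷ ys) zs (here y≡w)   _   = here y≡w
  ∈-remove (w ∷ ys) zs (there y∈)   y≢x = there (∈-remove ys zs y∈ y≢x)

  Unique-⊆⇒length≤ : (xs ys : List A) → Unique xs → xs ⊆ ys → length xs ≤ length ys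
  Unique-⊆⇒length≤ []       ys _            _   = z≤n
  Unique-⊆⇒length≤ (x ∷ xs) ys (x∉xs ∷ uxs) x∷xs⊆ys with ∈-∃++ (x∷xs⊆ys (here refl))
  ... | ys₁ , ys₂ , refl = subst (suc (length xs) ≤_) (sym (length-++-sucʳ ys₁ x ys₂))
        (s≤s (Unique-⊆⇒length≤ xs (ys₁ ++ ys₂) uxs
               (λ y∈xs → ∈-remove ys₁ ys₂ (x∷xs⊆ys (there y∈xs)) (λ y≡x → All.lookup x∉xs y∈xs (sym y≡x)))))

  Unique-map⁺-local : (f : A → B) {xs : List A} → (∀ {x y} → x ∈ xs → y ∈ xs → f x ≡ f y → x ≡ y) →
                      Unique xs → Unique (map f xs)
  Unique-map⁺-local f         _   []            = []
  Unique-map⁺-local f {x ∷ xs} inj (x∉xs ∷ uxs) =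
    All.map⁺ (All.tabulate λ y∈xs fx≡fy → All.lookup x∉xs y∈xs (inj (here refl) (there y∈xs) fx≡fy))
    ∷ Unique-map⁺-local f (λ x∈ y∈ → inj (there x∈) (there y∈)) uxs

  foldr-⊔-≥ : (f : A → ℕ) {x : A} {xs : List A} → x ∈ xs → f x ≤ foldr _⊔_ 0 (map f xs)
  foldr-⊔-≥ f (here refl) = m≤m⊔n _ _
  foldr-⊔-≥ f {xs = y ∷ _} (there x∈xs) = ≤-trans (foldr-⊔-≥ f x∈xs) (m≤n⊔m (f y) _)

  foldr-⊔-0 : (f : A → ℕ) (xs : List A) → (∀ {x} → x ∈ xs → f x ≡ 0) → foldr _⊔_ 0 (map f xs) ≡ 0
  foldr-⊔-0 f []       _ = refl
  foldr-⊔-0 f (x ∷ xs) h rewrite h (here refl) = foldr-⊔-0 f xs (h ∘ there)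

  module _ {k : ℕ} where

    ==-refl : (a : Fin k) → (a == a) ≡ true
    ==-refl a with a ≟ᶠ a
    ... | yes _   = refl
    ... | no a≢a = ⊥-elim (a≢a refl)

    ==⇒≡ : {a b : Fin k} → (a == b) ≡ true → a ≡ b
    ==⇒≡ {a} {b} h with a ≟ᶠ b
    ... | yes a≡b = a≡b

    ≢⇒==false : {a b : Fin k} → a ≢ b → (a == b) ≡ false
    ≢⇒==false {a} {b} a≢b with a ≟ᶠ b
    ... | yes a≡b = ⊥-elim (a≢b a≡b)
    ... | no _    = refl

  -- Uniformly random rankings

  module Rankings (G : Graph) where
    open Graph G

    -- Functions are enumerated through their tabulations, for which ≡ is extensional.
    tabulations : (k : ℕ) → List (Vec (Fin m) k)
    tabulations k = map V.tabulate (allFuns G k)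

    tabulations-suc : ∀ k → tabulations (suc k) ≡ cartesianProductWith (λ w x → x V.∷ w) (tabulations k) (allFin m)
    tabulations-suc k = begin
      tabulations (suc k)
        ≡⟨ map-concatMap V.tabulate _ (allFuns G k) ⟩
      concatMap (λ f → map V.tabulate (map _ (allFin m))) (allFuns G k)
        ≡⟨ concatMap-cong (λ f → sym (map-∘ (allFin m))) (allFuns G k) ⟩
      concatMap (λ f → map (λ x → x V.∷ V.tabulate f) (allFin m)) (allFuns G k)
        ≡⟨ concatMap-map (λ w → map (λ x → x V.∷ w) (allFin m)) V.tabulate (allFuns G k) ⟨
      concatMap (λ w → map (λ x → x V.∷ w) (allFin m)) (tabulations k)
        ≡⟨ cartesianProductWith≡concatMap (tabulations k) ⟨
      cartesianProductWith (λ w x → x V.∷ w) (tabulations k) (allFin m) ∎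
      where
      open ≡-Reasoning
      cartesianProductWith≡concatMap : (ws : List (Vec (Fin m) k)) →
        cartesianProductWith (λ w x → x V.∷ w) ws (allFin m) ≡ concatMap (λ w → map (λ x → x V.∷ w) (allFin m)) ws
      cartesianProductWith≡concatMap []       = refl
      cartesianProductWith≡concatMap (w ∷ ws) = cong (map (V._∷ w) (allFin m) ++_) (cartesianProductWith≡concatMap ws)

    tabulations-unique : ∀ k → Unique (tabulations k)
    tabulations-unique zero    = All.[] ∷ []
    tabulations-unique (suc k) rewrite tabulations-suc k =
      cartesianProductWith⁺ (λ w x → x V.∷ w) (λ eq → let x≡y , w≡v = ∷-injective eq in w≡v , x≡y)
                            (tabulations-unique k) (allFin⁺ m)

    ∈-tabulations : ∀ k (w : Vec (Fin m) k) → w ∈ tabulations k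
    ∈-tabulations zero    V.[]       = here refl
    ∈-tabulations (suc k) (x V.∷ w) rewrite tabulations-suc k =
      ∈-cartesianProductWith⁺ (λ w x → x V.∷ w) (∈-tabulations k w) (∈-allFin x)

    permute : ∀ {k} → (Fin k → Fin k) → Vec (Fin m) k → Vec (Fin m) k
    permute σ w = V.tabulate (V.lookup w ∘ σ)

    permute-inverse : ∀ {k} {σ τ : Fin k → Fin k} → (∀ x → σ (τ x) ≡ x) → ∀ w → permute τ (permute σ w) ≡ w
    permute-inverse {σ = σ} {τ} στ w =
      trans (tabulate-cong (λ i → trans (lookup∘tabulate (V.lookup w ∘ σ) (τ i)) (cong (V.lookup w) (στ i))))
            (tabulate∘lookup w)

    map-permute-↭ : ∀ {k} (π : Permutation′ k) → map (permute (π ⟨$⟩ʳ_)) (tabulations k) ↭ tabulations k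
    map-permute-↭ {k} π = ∼bag⇒↭ (unique∧set⇒bag unique (tabulations-unique k) (mk⇔ (λ _ → ∈-tabulations k _) onto))
      where
      unique : Unique (map (permute (π ⟨$⟩ʳ_)) (tabulations k))
      unique = map⁺ (λ {v} {w} eq → trans (sym (permute-inverse (λ _ → inverseʳ π) v))
                                   (trans (cong (permute (π ⟨$⟩ˡ_)) eq) (permute-inverse (λ _ → inverseʳ π) w)))
                    (tabulations-unique k)
      onto : ∀ {w} → w ∈ tabulations k → w ∈ map (permute (π ⟨$⟩ʳ_)) (tabulations k)
      onto {w} _ = subst (_∈ map (permute (π ⟨$⟩ʳ_)) (tabulations k)) (permute-inverse (λ _ → inverseˡ π) w)
                         (∈-map⁺ (permute (π ⟨$⟩ʳ_)) (∈-tabulations k (permute (π ⟨$⟩ˡ_) w)))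

    count-tabulations-permute : ∀ {k} (π : Permutation′ k) (Q : Vec (Fin m) k → Bool) →
      count Q (tabulations k) ≡ count (Q ∘ permute (π ⟨$⟩ʳ_)) (tabulations k)
    count-tabulations-permute {k} π Q =
      trans (sym (↭-length (filter-↭ (T? ∘ Q) (map-permute-↭ π)))) (count-map Q (permute (π ⟨$⟩ʳ_)) (tabulations k))

    isInjective⇒Injective : ∀ {f} → isInjective G f ≡ true → Injective _≡_ _≡_ f
    isInjective⇒Injective {f} h {i} {j} fi≡fj =
      ==⇒≡ (test-true (all-true⁻ _ (all-true⁻ _ h (∈-allFin i)) (∈-allFin j)))
      where
      test-true : not (f i == f j) ∨ (i == j) ≡ true → (i == j) ≡ true
      test-true t rewrite fi≡fj | ==-refl (f j) = t

    Injective⇒isInjective : ∀ {f} → Injective _≡_ _≡_ f → isInjective G f ≡ true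
    Injective⇒isInjective {f} inj = all-true⁺ _ (allFin m) λ {i} _ → all-true⁺ _ (allFin m) λ {j} _ → test i j
      where
      test : ∀ i j → not (f i == f j) ∨ (i == j) ≡ true
      test i j with f i ≟ᶠ f j
      ... | yes fi≡fj = subst (λ z → (i == z) ≡ true) (inj fi≡fj) (==-refl i)
      ... | no _      = refl

    isInjective-cong : ∀ {f g} → f ≗ g → isInjective G f ≡ isInjective G g
    isInjective-cong f≗g = ≡true-ext
      (λ h → Injective⇒isInjective λ eq → isInjective⇒Injective h (trans (f≗g _) (trans eq (sym (f≗g _)))))
      (λ h → Injective⇒isInjective λ eq → isInjective⇒Injective h (trans (sym (f≗g _)) (trans eq (f≗g _))))

    isInjective-∘-permutation : (π : Permutation′ m) (f : Fin m → Fin m) →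
                                isInjective G (f ∘ (π ⟨$⟩ʳ_)) ≡ isInjective G f
    isInjective-∘-permutation π f = ≡true-ext
      (λ h → Injective⇒isInjective λ {x} {y} fx≡fy →
        trans (sym (inverseʳ π)) (trans (cong (π ⟨$⟩ʳ_) (isInjective⇒Injective h
          (trans (cong f (inverseʳ π)) (trans fx≡fy (sym (cong f (inverseʳ π))))))) (inverseʳ π)))
      (λ h → Injective⇒isInjective λ fσx≡fσy →
        trans (sym (inverseˡ π)) (trans (cong (π ⟨$⟩ˡ_) (isInjective⇒Injective h fσx≡fσy)) (inverseˡ π)))

    Extensional : ((Fin m → Fin m) → Bool) → Set
    Extensional p = ∀ {f g} → f ≗ g → p f ≡ p g

    count-rankings-∘-permutation : (π : Permutation′ m) (p : (Fin m → Fin m) → Bool) → Extensional p →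
      count p (rankings G) ≡ count (λ ρ → p (ρ ∘ (π ⟨$⟩ʳ_))) (rankings G)
    count-rankings-∘-permutation π p p-ext = begin
      count p (rankings G)
        ≡⟨ count-filterᵇ p (isInjective G) (allFuns G m) ⟩
      count P (allFuns G m)
        ≡⟨ count-cong (λ f → P-ext (λ i → sym (lookup∘tabulate f i))) (allFuns G m) ⟩
      count (P ∘ V.lookup ∘ V.tabulate) (allFuns G m)
        ≡⟨ count-map (P ∘ V.lookup) V.tabulate (allFuns G m) ⟨
      count (P ∘ V.lookup) (tabulations m)
        ≡⟨ count-tabulations-permute π (P ∘ V.lookup) ⟩
      count (P ∘ V.lookup ∘ permute σ) (tabulations m)
        ≡⟨ count-map (P ∘ V.lookup ∘ permute σ) V.tabulate (allFuns G m) ⟩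
      count (P ∘ V.lookup ∘ permute σ ∘ V.tabulate) (allFuns G m)
        ≡⟨ count-cong (λ f → P-ext (λ i → trans (lookup∘tabulate _ i) (lookup∘tabulate f (σ i)))) (allFuns G m) ⟩
      count (λ f → P (f ∘ σ)) (allFuns G m)
        ≡⟨ count-cong (λ f → cong (_∧ p (f ∘ σ)) (isInjective-∘-permutation π f)) (allFuns G m) ⟩
      count (λ f → isInjective G f ∧ p (f ∘ σ)) (allFuns G m)
        ≡⟨ count-filterᵇ (λ ρ → p (ρ ∘ σ)) (isInjective G) (allFuns G m) ⟨
      count (λ ρ → p (ρ ∘ σ)) (rankings G) ∎
      where
      open ≡-Reasoning
      σ = π ⟨$⟩ʳ_
      P : (Fin m → Fin m) → Bool
      P f = isInjective G f ∧ p f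
      P-ext : Extensional P
      P-ext f≗g = cong₂ _∧_ (isInjective-cong f≗g) (p-ext f≗g)

    ∈-rankings⇒Injective : ∀ {ρ} → ρ ∈ rankings G → Injective _≡_ _≡_ ρ
    ∈-rankings⇒Injective ρ∈ =
      isInjective⇒Injective (T⇒≡true (proj₂ (∈-filter⁻ (T? ∘ isInjective G) {xs = allFuns G m} ρ∈)))

    -- isArgmin of Defs, which ignores its tree argument.
    isLeast : (Fin m → Fin m) → Fin m → List (Fin m) → Bool
    isLeast ρ e S = any (_== e) S ∧ all (λ e′ → toℕ (ρ e) ≤ᵇ toℕ (ρ e′)) S

    isLeast-ext : ∀ e S → Extensional (λ ρ → isLeast ρ e S)
    isLeast-ext e S ρ≗ρ′ =
      cong (any (_== e) S ∧_) (all-cong (λ x → cong₂ (λ a b → toℕ a ≤ᵇ toℕ b) (ρ≗ρ′ e) (ρ≗ρ′ x)) S)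

    ∈⇒any-== : ∀ {e : Fin m} {S} → e ∈ S → any (_== e) S ≡ true
    ∈⇒any-== {e} e∈S = any-true⁺ (_== e) e∈S (==-refl e)

    isLeast⇒∈ : ∀ {ρ e S} → isLeast ρ e S ≡ true → e ∈ S
    isLeast⇒∈ {e = e} {S} h with any-true⁻ (_== e) S (∧-trueˡ h)
    ... | x , x∈S , x==e = subst (_∈ S) (==⇒≡ x==e) x∈S

    isLeast⇒≤ : ∀ {ρ e S x} → isLeast ρ e S ≡ true → x ∈ S → toℕ (ρ e) ≤ toℕ (ρ x)
    isLeast⇒≤ {ρ} {e} {S} h x∈S =
      ≤ᵇ⇒≤ _ _ (≡true⇒T (all-true⁻ (λ e′ → toℕ (ρ e) ≤ᵇ toℕ (ρ e′)) (∧-trueʳ {any (_== e) S} h) x∈S))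

    isLeast-unique : ∀ {ρ a b S} → Injective _≡_ _≡_ ρ → isLeast ρ a S ≡ true → isLeast ρ b S ≡ true → a ≡ b
    isLeast-unique {ρ} {a} {b} {S} inj ha hb =
      inj (toℕ-injective (≤-antisym (isLeast⇒≤ {ρ} {a} {S} ha (isLeast⇒∈ {ρ} {b} hb))
                                    (isLeast⇒≤ {ρ} {b} {S} hb (isLeast⇒∈ {ρ} {a} ha))))

    isLeast-⊆ : ∀ {ρ e S S′} → isLeast ρ e S ≡ true → e ∈ S′ → S′ ⊆ S → isLeast ρ e S′ ≡ true
    isLeast-⊆ {ρ} {e} {S} {S′} least e∈S′ S′⊆S =
      ∧-true (∈⇒any-== e∈S′)
             (all-true⁺ _ S′ λ y∈S′ → all-true⁻ _ (∧-trueʳ {any (_== e) S} least) (S′⊆S y∈S′))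

    transpose-∈ : ∀ {S : List (Fin m)} {i j x} → i ∈ S → j ∈ S → x ∈ S → transpose i j ⟨$⟩ʳ x ∈ S
    transpose-∈ {i = i} {j} {x} i∈S j∈S x∈S with x ≟ᶠ i
    ... | yes _ = j∈S
    ... | no _ with x ≟ᶠ j
    ...   | yes _ = i∈S
    ...   | no _  = x∈S

    module _ {e e′ : Fin m} {S : List (Fin m)} (e∈S : e ∈ S) (e′∈S : e′ ∈ S) where

      all-∘-transpose : (q : Fin m → Bool) → all (q ∘ (transpose e e′ ⟨$⟩ʳ_)) S ≡ all q S
      all-∘-transpose q = ≡true-ext
        (λ h → all-true⁺ q S λ {y} y∈S → subst (λ z → q z ≡ true) (inverseʳ (transpose e e′))
                                                (all-true⁻ (q ∘ (transpose e e′ ⟨$⟩ʳ_)) h (transpose-∈ e′∈S e∈S y∈S)))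
        (λ h → all-true⁺ (q ∘ (transpose e e′ ⟨$⟩ʳ_)) S λ y∈S → all-true⁻ q h (transpose-∈ e∈S e′∈S y∈S))

      isLeast-∘-transpose : ∀ ρ → isLeast (ρ ∘ (transpose e e′ ⟨$⟩ʳ_)) e S ≡ isLeast ρ e′ S
      isLeast-∘-transpose ρ = cong₂ _∧_ (trans (∈⇒any-== e∈S) (sym (∈⇒any-== e′∈S))) (begin
        all (λ y → toℕ (ρ (τ e)) ≤ᵇ toℕ (ρ (τ y))) S
          ≡⟨ all-cong (λ y → cong (λ z → toℕ (ρ z) ≤ᵇ toℕ (ρ (τ y))) τe≡e′) S ⟩
        all (λ y → toℕ (ρ e′) ≤ᵇ toℕ (ρ (τ y))) S
          ≡⟨ all-∘-transpose (λ y → toℕ (ρ e′) ≤ᵇ toℕ (ρ y)) ⟩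
        all (λ y → toℕ (ρ e′) ≤ᵇ toℕ (ρ y)) S
          ∎)
        where
        open ≡-Reasoning
        τ = transpose e e′ ⟨$⟩ʳ_
        τe≡e′ : τ e ≡ e′
        τe≡e′ rewrite dec-true (e ≟ᶠ e) refl = refl

      count-isLeast-swap : count (λ ρ → isLeast ρ e S) (rankings G) ≡ count (λ ρ → isLeast ρ e′ S) (rankings G)
      count-isLeast-swap =
        trans (count-rankings-∘-permutation (transpose e e′) (λ ρ → isLeast ρ e S) (isLeast-ext e S))
              (count-cong isLeast-∘-transpose (rankings G))

    -- Every element of a duplicate-free S is the least one for the same number of rankings, and
    -- for each ranking at most one element is least; hence Pr[e is least in S] ≤ 1 / |S|.
    length*count-isLeast≤length-rankings : ∀ {e S} → Unique S → e ∈ S →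
      length S * count (λ ρ → isLeast ρ e S) (rankings G) ≤ length (rankings G)
    length*count-isLeast≤length-rankings {e} {S} uniqueS e∈S = begin
      length S * c e                                     ≡⟨ sum-map-const (c e) S ⟨
      sum (map (λ _ → c e) S)                            ≡⟨ cong sum (map-cong-local (All.tabulate (count-isLeast-swap e∈S))) ⟩
      sum (map c S)                                      ≡⟨ sum-count-swap (λ e′ ρ → isLeast ρ e′ S) S R ⟩
      sum (map (λ ρ → count (λ e′ → isLeast ρ e′ S) S) R) ≤⟨ sum-map-mono _ _ R at-most-one-least ⟩
      sum (map (λ _ → 1) R)                              ≡⟨ sum-map-const 1 R ⟩
      length R * 1                                       ≡⟨ *-identityʳ (length R) ⟩
      length R                                           ∎
      where
      open ≤-Reasoning
      R = rankings G
      c : Fin m → ℕ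
      c e′ = count (λ ρ → isLeast ρ e′ S) R
      at-most-one-least : ∀ {ρ} → ρ ∈ R → count (λ e′ → isLeast ρ e′ S) S ≤ 1
      at-most-one-least {ρ} ρ∈R =
        count≤1 _ S uniqueS (λ {a} {b} _ _ → isLeast-unique {ρ} {a} {b} {S} (∈-rankings⇒Injective ρ∈R))

  -- Arithmetic of the charging windows

  12*d≤7*[d+i]⇒d≤2*i : ∀ d i → 12 * d ≤ 7 * (d + i) → d ≤ 2 * i
  12*d≤7*[d+i]⇒d≤2*i d i 12d≤7[d+i] = *-cancelˡ-≤ 5 (begin
    5 * d        ≤⟨ +-cancelˡ-≤ (7 * d) (5 * d) (7 * i) 7d+5d≤7d+7i ⟩
    7 * i        ≤⟨ *-monoˡ-≤ i {7} {10} (m≤n+m 7 3) ⟩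
    10 * i       ≡⟨ *-assoc 5 2 i ⟩
    5 * (2 * i)  ∎)
    where
    open ≤-Reasoning
    7d+5d≤7d+7i : 7 * d + 5 * d ≤ 7 * d + 7 * i
    7d+5d≤7d+7i = subst₂ _≤_ (*-distribʳ-+ d 7 5) (*-distribˡ-+ 7 d i) 12d≤7[d+i]

  6*[n/6]≤n : ∀ k → 6 * (k / 6) ≤ k
  6*[n/6]≤n k = subst (_≤ k) (*-comm (k / 6) 6) (m/n*n≤m k 6)

  -- The lowWindow k ≥ k/6 edges above a node at depth k reach up to depth 5⌊k/6⌋ + 1.
  lowWindow : ℕ → ℕ
  lowWindow k = k ∸ 5 * (k / 6)

  5*[n/6]≤n : ∀ k → 5 * (k / 6) ≤ k
  5*[n/6]≤n k = ≤-trans (*-monoˡ-≤ (k / 6) (n≤1+n 5)) (6*[n/6]≤n k)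

  lowWindow[n]+5*[n/6]≡n : ∀ k → lowWindow k + 5 * (k / 6) ≡ k
  lowWindow[n]+5*[n/6]≡n k = m∸n+n≡m (5*[n/6]≤n k)

  n≤6*lowWindow[n] : ∀ k → k ≤ 6 * lowWindow k
  n≤6*lowWindow[n] k = +-cancelʳ-≤ (6 * (5 * q)) k (6 * lowWindow k) (begin
    k + 6 * (5 * q)               ≡⟨ cong (k +_) (6*[5*q]≡5*[6*q] q) ⟩
    k + 5 * (6 * q)               ≤⟨ +-monoʳ-≤ k (*-monoʳ-≤ 5 (6*[n/6]≤n k)) ⟩
    6 * k                         ≡⟨ cong (6 *_) (lowWindow[n]+5*[n/6]≡n k) ⟨
    6 * (lowWindow k + 5 * q)     ≡⟨ *-distribˡ-+ 6 (lowWindow k) (5 * q) ⟩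
    6 * lowWindow k + 6 * (5 * q) ∎)
    where
    open ≤-Reasoning
    q = k / 6
    6*[5*q]≡5*[6*q] : ∀ q → 6 * (5 * q) ≡ 5 * (6 * q)
    6*[5*q]≡5*[6*q] = solve-∀

  lowWindow[n]≤n : ∀ k → lowWindow k ≤ k
  lowWindow[n]≤n k = m∸n≤m k (5 * (k / 6))

  lowWindow>0 : ∀ k → 1 ≤ k → 1 ≤ lowWindow k
  lowWindow>0 k 1≤k with lowWindow k | n≤6*lowWindow[n] k
  ... | zero  | k≤0 = ≤-trans 1≤k k≤0
  ... | suc _ | _   = s≤s z≤n

  1+5*[n/6]+lowWindow[n]≡1+n : ∀ k → suc (5 * (k / 6)) + lowWindow k ≡ suc k
  1+5*[n/6]+lowWindow[n]≡1+n k = cong suc (trans (+-comm (5 * (k / 6)) (lowWindow k)) (lowWindow[n]+5*[n/6]≡n k))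

  12∣d∧d≤2k⇒5d<12[1+5[k/6]] : ∀ {d} k → 12 ∣ d → d ≤ 2 * k → 5 * d < 12 * suc (5 * (k / 6))
  12∣d∧d≤2k⇒5d<12[1+5[k/6]] k (divides t refl) 12t≤2k = begin-strict
    5 * (t * 12)           ≡⟨ 5*[t*12]≡12*[5*t] t ⟩
    12 * (5 * t)           ≤⟨ *-monoʳ-≤ 12 (*-monoʳ-≤ 5 t≤k/6) ⟩
    12 * (5 * (k / 6))     <⟨ *-monoʳ-< 12 (n<1+n (5 * (k / 6))) ⟩
    12 * suc (5 * (k / 6)) ∎
    where
    open ≤-Reasoning
    5*[t*12]≡12*[5*t] : ∀ t → 5 * (t * 12) ≡ 12 * (5 * t)
    5*[t*12]≡12*[5*t] = solve-∀
    t*12≡2*[t*6] : ∀ t → t * 12 ≡ 2 * (t * 6)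
    t*12≡2*[t*6] = solve-∀
    t≤k/6 : t ≤ k / 6
    t≤k/6 = subst (_≤ k / 6) (m*n/n≡m t 6)
                  (/-monoˡ-≤ 6 (*-cancelˡ-≤ {t * 6} {k} 2 (subst (_≤ 2 * k) (t*12≡2*[t*6] t) 12t≤2k)))

  -- The node at depth k + 1 + ⌊k/6⌋ is charged with the edge ⌊k/6⌋ + 1 above it; highOffset recovers
  -- this offset from the depth alone.
  highOffset : ℕ → ℕ
  highOffset d = suc ((d ∸ 1) / 7)

  2≤n⇒1+highOffset[n]≤n : ∀ d → 2 ≤ d → suc (highOffset d) ≤ d
  2≤n⇒1+highOffset[n]≤n (suc zero)    (s≤s ())
  2≤n⇒1+highOffset[n]≤n (suc (suc e)) _ = s≤s (m/n<m (suc e) 7 (s≤s (s≤s z≤n)))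

  n≤7*[1+highOffset[n]] : ∀ d → d ≤ 7 * suc (highOffset d)
  n≤7*[1+highOffset[n]] zero    = z≤n
  n≤7*[1+highOffset[n]] (suc e) = begin
    suc e                      ≡⟨ cong suc (m≡m%n+[m/n]*n e 7) ⟩
    suc (e % 7 + e / 7 * 7)    ≤⟨ +-monoˡ-≤ (e / 7 * 7) (m%n<n e 7) ⟩
    7 + e / 7 * 7              ≤⟨ m≤m+n (7 + e / 7 * 7) 7 ⟩
    7 + e / 7 * 7 + 7          ≡⟨ 7+q*7+7≡7*[2+q] (e / 7) ⟩
    7 * suc (highOffset (suc e)) ∎
    where
    open ≤-Reasoning
    7+q*7+7≡7*[2+q] : ∀ q → 7 + q * 7 + 7 ≡ 7 * suc (suc q)
    7+q*7+7≡7*[2+q] = solve-∀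

  highOffset[k+1+k/6]≡1+k/6 : ∀ k → highOffset (k + suc (k / 6)) ≡ suc (k / 6)
  highOffset[k+1+k/6]≡1+k/6 k = cong suc (begin
    (k + suc q ∸ 1) / 7        ≡⟨ cong (λ x → x / 7) (cong (_∸ 1) (+-suc k q)) ⟩
    (k + q) / 7                ≡⟨ cong (_/ 7) (cong (_+ q) (m≡m%n+[m/n]*n k 6)) ⟩
    (k % 6 + q * 6 + q) / 7    ≡⟨ cong (_/ 7) (r+q*6+q≡r+q*7 (k % 6) q) ⟩
    (k % 6 + q * 7) / 7        ≡⟨ +-distrib-/-∣ʳ (k % 6) (divides q refl) ⟩
    k % 6 / 7 + q * 7 / 7      ≡⟨ cong₂ _+_ (m<n⇒m/n≡0 (m<n⇒m<1+n (m%n<n k 6))) (m*n/n≡m q 7) ⟩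
    q                          ∎)
    where
    open ≡-Reasoning
    q = k / 6
    r+q*6+q≡r+q*7 : ∀ r q → r + q * 6 + q ≡ r + q * 7
    r+q*6+q≡r+q*7 = solve-∀

  12∣d∧2k<d⇒12[k+1+k/6]≤7d : ∀ {d} k → 12 ∣ d → 2 * k < d → 12 * (k + suc (k / 6)) ≤ 7 * d
  12∣d∧2k<d⇒12[k+1+k/6]≤7d k (divides t refl) 2k<12t = begin
    12 * (k + suc (k / 6))     ≤⟨ *-monoʳ-≤ 12 (+-mono-≤ (<⇒≤ k<6t) q<t) ⟩
    12 * (t * 6 + t)           ≡⟨ 12*[t*6+t]≡7*[t*12] t ⟩
    7 * (t * 12)               ∎
    where
    open ≤-Reasoning
    t*12≡2*[t*6] : ∀ t → t * 12 ≡ 2 * (t * 6)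
    t*12≡2*[t*6] = solve-∀
    12*[t*6+t]≡7*[t*12] : ∀ t → 12 * (t * 6 + t) ≡ 7 * (t * 12)
    12*[t*6+t]≡7*[t*12] = solve-∀
    k<6t : k < t * 6
    k<6t = *-cancelˡ-< 2 k (t * 6) (subst (2 * k <_) (t*12≡2*[t*6] t) 2k<12t)
    q<t : suc (k / 6) ≤ t
    q<t = *-cancelʳ-< 6 (k / 6) t (≤-<-trans (m/n*n≤m k 6) k<6t)

  m<n*o⇒0<o : ∀ {m} n {o} → m < n * o → 0 < o
  m<n*o⇒0<o {m} n {zero}  m<n*0 = contradiction (subst (m <_) (*-zeroʳ n) m<n*0) λ ()
  m<n*o⇒0<o     n {suc o} _     = s≤s z≤n

  d≤c*L∧L*x≤N⇒x*d≤c*N : ∀ c L {d x N} → d ≤ c * L → L * x ≤ N → x * d ≤ c * N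
  d≤c*L∧L*x≤N⇒x*d≤c*N c L {d} {x} {N} d≤cL Lx≤N = begin
    x * d        ≤⟨ *-monoʳ-≤ x d≤cL ⟩
    x * (c * L)  ≡⟨ x*[c*L]≡c*[L*x] x c L ⟩
    c * (L * x)  ≤⟨ *-monoʳ-≤ c Lx≤N ⟩
    c * N        ∎
    where
    open ≤-Reasoning
    x*[c*L]≡c*[L*x] : ∀ x c L → x * (c * L) ≡ c * (L * x)
    x*[c*L]≡c*[L*x] = solve-∀

  -- Ancestors and paths in a rooted tree

  module TreePaths (G : Graph) {r : Fin (Graph.n G)} (T : RootedTree G r) where
    open Graph G
    open RootedTree T

    ancestor : ℕ → Fin n → Fin n
    ancestor = anc G T

    dep>0⇒≢root : ∀ {v} → 1 ≤ dep v → v ≢ r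
    dep>0⇒≢root 0<dep refl = <⇒≢ 0<dep (sym dep-r)

    ≢root⇒dep>0 : ∀ {v} → inT v ≡ true → v ≢ r → 1 ≤ dep v
    ≢root⇒dep>0 {v} v∈T v≢r rewrite proj₁ (proj₂ (step v v∈T v≢r)) = s≤s z≤n

    ancestor-inT×dep : ∀ k {v} → inT v ≡ true → k ≤ dep v →
                       inT (ancestor k v) ≡ true × dep (ancestor k v) + k ≡ dep v
    ancestor-inT×dep zero    v∈T _ = v∈T , +-identityʳ _
    ancestor-inT×dep (suc k) v∈T 1+k≤dep with ancestor-inT×dep k v∈T (≤-trans (n≤1+n k) 1+k≤dep)
    ... | a∈T , dep-a = proj₁ step-a , trans (+-suc _ k) (trans (cong (_+ k) (sym (proj₁ (proj₂ step-a)))) dep-a)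
      where
      0<dep-a : 1 ≤ dep (ancestor k _)
      0<dep-a = +-cancelʳ-≤ k 1 _ (subst (suc k ≤_) (sym dep-a) 1+k≤dep)
      step-a = step _ a∈T (dep>0⇒≢root 0<dep-a)

    ancestor-inT : ∀ k {v} → inT v ≡ true → k ≤ dep v → inT (ancestor k v) ≡ true
    ancestor-inT k v∈T k≤dep = proj₁ (ancestor-inT×dep k v∈T k≤dep)

    dep-ancestor : ∀ k {v} → inT v ≡ true → k ≤ dep v → dep (ancestor k v) + k ≡ dep v
    dep-ancestor k v∈T k≤dep = proj₂ (ancestor-inT×dep k v∈T k≤dep)

    ancestor-+ : ∀ j i v → ancestor (j + i) v ≡ ancestor j (ancestor i v)
    ancestor-+ zero    i v = refl
    ancestor-+ (suc j) i v = cong par (ancestor-+ j i v)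

    ancestor-≢root : ∀ j {v} → inT v ≡ true → j < dep v → ancestor j v ≢ r
    ancestor-≢root j v∈T j<dep =
      dep>0⇒≢root (+-cancelʳ-≤ j 1 _ (subst (suc j ≤_) (sym (dep-ancestor j v∈T (<⇒≤ j<dep))) j<dep))

    -- Two distinct tree nodes sharing their parent edge would each be the parent of the other.
    pe-injective : ∀ {x y} → inT x ≡ true → inT y ≡ true → x ≢ r → y ≢ r → pe x ≡ pe y → x ≡ y
    pe-injective {x} {y} x∈T y∈T x≢r y≢r pex≡pey with step x x∈T x≢r | step y y∈T y≢r
    ... | _ , dep-x , joins-x | _ , dep-y , joins-y = same-edge joins-x (subst (λ e → Joins G e y (par y)) (sym pex≡pey) joins-y)
      where
      not-mutual-parents : x ≡ par y → y ≡ par x → ⊥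
      not-mutual-parents x≡py y≡px = <⇒≢ (m<n⇒m<1+n (n<1+n (dep x))) (begin
        dep x                   ≡⟨ dep-x ⟩
        suc (dep (par x))       ≡⟨ cong (suc ∘ dep) y≡px ⟨
        suc (dep y)             ≡⟨ cong suc dep-y ⟩
        suc (suc (dep (par y))) ≡⟨ cong (suc ∘ suc ∘ dep) x≡py ⟨
        suc (suc (dep x))       ∎)
        where open ≡-Reasoning
      same-edge : Joins G (pe x) x (par x) → Joins G (pe x) y (par y) → x ≡ y
      same-edge (inj₁ (s≡x , _))   (inj₁ (s≡y , _))   = trans (sym s≡x) s≡y
      same-edge (inj₂ (_ , t≡x))   (inj₂ (_ , t≡y))   = trans (sym t≡x) t≡y
      same-edge (inj₁ (s≡x , t≡px)) (inj₂ (s≡py , t≡y)) =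
        ⊥-elim (not-mutual-parents (trans (sym s≡x) s≡py) (trans (sym t≡y) t≡px))
      same-edge (inj₂ (s≡px , t≡x)) (inj₁ (s≡y , t≡py)) =
        ⊥-elim (not-mutual-parents (trans (sym t≡x) t≡py) (trans (sym s≡y) s≡px))

    ancestorPath : Fin n → ℕ → List (Fin m)
    ancestorPath x L = map (λ j → pe (ancestor j x)) (upTo L)

    length-ancestorPath : ∀ x L → length (ancestorPath x L) ≡ L
    length-ancestorPath x L = trans (length-map _ (upTo L)) (length-upTo L)

    ancestorPath-unique : ∀ {x L} → inT x ≡ true → L ≤ dep x → Unique (ancestorPath x L)
    ancestorPath-unique {x} {L} x∈T L≤dep = Unique-map⁺-local _ pe-ancestor-injective (upTo⁺ L)
      where
      pe-ancestor-injective : ∀ {i j} → i ∈ upTo L → j ∈ upTo L → pe (ancestor i x) ≡ pe (ancestor j x) → i ≡ j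
      pe-ancestor-injective {i} {j} i∈ j∈ eq = +-cancelˡ-≡ _ i j (begin
        dep (ancestor i x) + i  ≡⟨ dep-ancestor i x∈T (<⇒≤ i<dep) ⟩
        dep x                   ≡⟨ dep-ancestor j x∈T (<⇒≤ j<dep) ⟨
        dep (ancestor j x) + j  ≡⟨ cong (λ a → dep a + j) ancestors-equal ⟨
        dep (ancestor i x) + j  ∎)
        where
        open ≡-Reasoning
        i<dep = <-≤-trans (∈-upTo⁻ i∈) L≤dep
        j<dep = <-≤-trans (∈-upTo⁻ j∈) L≤dep
        ancestors-equal : ancestor i x ≡ ancestor j x
        ancestors-equal = pe-injective (ancestor-inT i x∈T (<⇒≤ i<dep)) (ancestor-inT j x∈T (<⇒≤ j<dep))
                                       (ancestor-≢root i x∈T i<dep) (ancestor-≢root j x∈T j<dep) eq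

    ∈-ancestorPath⁺ : ∀ x {L j} → j < L → pe (ancestor j x) ∈ ancestorPath x L
    ∈-ancestorPath⁺ x j<L = ∈-map⁺ _ (∈-upTo⁺ j<L)

    ∈-ancestorPath⁻ : ∀ x L {e} → e ∈ ancestorPath x L → Σ ℕ λ j → j < L × e ≡ pe (ancestor j x)
    ∈-ancestorPath⁻ x L e∈ with ∈-map⁻ _ e∈
    ... | j , j∈ , e≡ = j , ∈-upTo⁻ j∈ , e≡

    isDesc-ancestor : ∀ k {x} → inT x ≡ true → k ≤ dep x → isDesc G T (ancestor k x) x ≡ true
    isDesc-ancestor k {x} x∈T k≤dep rewrite x∈T =
      any-true⁺ (λ j → ancestor j x == ancestor k x) (∈-upTo⁺ (s≤s k≤dep)) (==-refl _)

    reach-≥ : ∀ {a x} → isDesc G T a x ≡ true → dep x ∸ dep a ≤ reach G T a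
    reach-≥ {a} {x} a≼x = subst (_≤ reach G T a) (cong (λ b → if b then dep x ∸ dep a else 0) a≼x)
                                (foldr-⊔-≥ (λ y → if isDesc G T a y then dep y ∸ dep a else 0) (∈-allFin x))

    -- The reach of the ancestor a is at least d(v) − d(a), which is ≥ d(a)/2 when 12 d(a) ≤ 7 d(v).
    inVstar-ancestor : ∀ i {v} → inT v ≡ true → i ≤ dep v → 12 * dep (ancestor i v) ≤ 7 * dep v →
                       inVstar G T (ancestor i v) ≡ true
    inVstar-ancestor i {v} v∈T i≤dep 12a≤7v rewrite ancestor-inT i v∈T i≤dep =
      T⇒≡true (≤⇒≤ᵇ (≤-trans a≤2i (*-monoʳ-≤ 2 i≤reach)))
      where
      a = ancestor i v
      dep-a : dep a + i ≡ dep v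
      dep-a = dep-ancestor i v∈T i≤dep
      a≤2i : dep a ≤ 2 * i
      a≤2i = 12*d≤7*[d+i]⇒d≤2*i (dep a) i (subst (λ d → 12 * dep a ≤ 7 * d) (sym dep-a) 12a≤7v)
      i≤reach : i ≤ reach G T a
      i≤reach = subst (_≤ reach G T a) (trans (cong (_∸ dep a) (sym dep-a)) (m+n∸m≡n (dep a) i))
                      (reach-≥ (isDesc-ancestor i v∈T i≤dep))

    isDesc-root⇒≡root : ∀ {a} → isDesc G T a r ≡ true → a ≡ r
    isDesc-root⇒≡root {a} a≼r with any-true⁻ (λ k → ancestor k r == a) (upTo (suc (dep r))) (∧-trueʳ {inT r} a≼r)
    ... | k , k∈ , anc-k≡a with ∈-upTo⁻ k∈
    ...   | s≤s k≤dep-r rewrite dep-r with k≤dep-r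
    ...     | z≤n = sym (==⇒≡ anc-k≡a)

    treeDist-root : ∀ v → treeDist G T r v ≡ dep v
    treeDist-root v = cong₂ (λ a b → a + dep v ∸ 2 * b) dep-r (foldr-⊔-0 _ (allFin n) common-ancestor-is-root)
      where
      common-ancestor-is-root : ∀ {a} → a ∈ allFin n → (if isDesc G T a r ∧ isDesc G T a v then dep a else 0) ≡ 0
      common-ancestor-is-root {a} _ with isDesc G T a r in a≼r
      ... | false = refl
      ... | true with isDesc G T a v
      ...   | true  = trans (cong dep (isDesc-root⇒≡root a≼r)) dep-r
      ...   | false = refl

    inCentralWindow : Fin n → ℕ → Bool
    inCentralWindow v k = (5 * dep v <ᵇ 12 * dep (ancestor k v)) ∧ (12 * dep (ancestor k v) ≤ᵇ 7 * dep v)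

    ∈-central⁺ : ∀ v {i} → i < dep v → 5 * dep v < 12 * dep (ancestor i v) → 12 * dep (ancestor i v) ≤ 7 * dep v →
                 pe (ancestor i v) ∈ central G T v
    ∈-central⁺ v i<dep lower upper = ∈-map⁺ _ (∈-filter⁺ (T? ∘ inCentralWindow v) (∈-upTo⁺ i<dep)
                                        (≡true⇒T (∧-true (T⇒≡true (<⇒<ᵇ lower)) (T⇒≡true (≤⇒≤ᵇ upper)))))

    ∈-central⁻ : ∀ v {e} → e ∈ central G T v →
                 Σ ℕ λ i → i < dep v × 5 * dep v < 12 * dep (ancestor i v) × 12 * dep (ancestor i v) ≤ 7 * dep v
                           × e ≡ pe (ancestor i v)
    ∈-central⁻ v e∈ with ∈-map⁻ _ e∈
    ... | i , i∈ , e≡ with ∈-filter⁻ (T? ∘ inCentralWindow v) {xs = upTo (dep v)} i∈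
    ...   | i∈upTo , window = i , ∈-upTo⁻ i∈upTo , <ᵇ⇒< _ _ (≡true⇒T (∧-trueˡ window′))
                            , ≤ᵇ⇒≤ _ _ (≡true⇒T (∧-trueʳ {5 * dep v <ᵇ 12 * dep (ancestor i v)} window′)) , e≡
      where
      window′ = T⇒≡true window

    -- lo + L ≤ 1 + d(x) says that the top node of the path, at depth d(x) + 1 − L, has depth ≥ lo.
    ancestorPath⊆central : ∀ {v} i {lo L} → inT v ≡ true → i ≤ dep v →
      5 * dep v < 12 * lo → lo + L ≤ suc (dep (ancestor i v)) → 12 * dep (ancestor i v) ≤ 7 * dep v →
      ancestorPath (ancestor i v) L ⊆ central G T v
    ancestorPath⊆central {v} i {lo} {L} v∈T i≤dep 5v<12lo lo+L≤1+x 12x≤7v e∈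
      with ∈-ancestorPath⁻ (ancestor i v) L e∈
    ... | j , j<L , e≡ = subst (_∈ central G T v) (sym (trans e≡ (cong pe (sym (ancestor-+ j i v)))))
                           (∈-central⁺ v j+i<dep (<-≤-trans 5v<12lo (*-monoʳ-≤ 12 lo≤y))
                                                 (≤-trans (*-monoʳ-≤ 12 y≤x) 12x≤7v))
      where
      x = dep (ancestor i v)
      x+i≡v : x + i ≡ dep v
      x+i≡v = dep-ancestor i v∈T i≤dep
      lo+j<1+x : lo + j < suc x
      lo+j<1+x = <-≤-trans (+-monoʳ-< lo j<L) lo+L≤1+x
      0<lo : 1 ≤ lo
      0<lo = m<n*o⇒0<o 12 5v<12lo
      j<x : j < x
      j<x = ≤-trans (+-monoˡ-≤ j 0<lo) (s≤s⁻¹ lo+j<1+x)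
      j+i<dep : j + i < dep v
      j+i<dep = subst (j + i <_) x+i≡v (+-monoˡ-< i j<x)
      y = dep (ancestor (j + i) v)
      y+j≡x : y + j ≡ x
      y+j≡x = +-cancelʳ-≡ i _ _ (trans (+-assoc y j i) (trans (dep-ancestor (j + i) v∈T (<⇒≤ j+i<dep)) (sym x+i≡v)))
      lo≤y : lo ≤ y
      lo≤y = +-cancelʳ-≤ j lo y (subst (lo + j ≤_) (sym y+j≡x) (s≤s⁻¹ lo+j<1+x))
      y≤x : y ≤ x
      y≤x = subst (y ≤_) y+j≡x (m≤m+n y j)

  -- Charging hubs to nodes of V*

  module Charging (G : Graph) (u : Fin (Graph.n G)) (T : RootedTree G u)
                  (12∣dep : ∀ v → Graph.terminal G v ≡ true → 12 ∣ RootedTree.dep T v) where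
    open Graph G
    open RootedTree T
    open Rankings G
    open TreePaths G T

    candidate : Fin n → Bool
    candidate x = inVstar G T x ∧ not (x == u)

    dep>0⇒candidate : ∀ {x} → 1 ≤ dep x → inVstar G T x ≡ true → candidate x ≡ true
    dep>0⇒candidate 0<dep x∈V* = ∧-true x∈V* (cong not (≢⇒==false (dep>0⇒≢root 0<dep)))

    lowPath : Fin n → List (Fin m)
    lowPath x = ancestorPath x (lowWindow (dep x))

    highEdge : Fin n → Fin m
    highEdge x = pe (ancestor (highOffset (dep x)) x)

    highPath : Fin n → List (Fin m)
    highPath x = ancestorPath x (suc (highOffset (dep x)))

    chargedLow : (Fin m → Fin m) → Fin n → Bool
    chargedLow ρ x = candidate x ∧ isLeast ρ (pe x) (lowPath x)

    chargedHigh : (Fin m → Fin m) → Fin n → Bool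
    chargedHigh ρ x = candidate x ∧ ((2 ≤ᵇ dep x) ∧ isLeast ρ (highEdge x) (highPath x))

    chargeLow : ∀ {ρ v i} → terminal v ≡ true → i < dep v →
      5 * dep v < 12 * dep (ancestor i v) → 12 * dep (ancestor i v) ≤ 7 * dep v → dep v ≤ 2 * dep (ancestor i v) →
      isLeast ρ (pe (ancestor i v)) (central G T v) ≡ true → chargedLow ρ (ancestor i v) ≡ true
    chargeLow {ρ} {v} {i} tv i<dep lower upper v≤2k least =
      ∧-true (dep>0⇒candidate 0<k (inVstar-ancestor i v∈T (<⇒≤ i<dep) upper))
             (isLeast-⊆ {ρ} least (∈-ancestorPath⁺ a (lowWindow>0 k 0<k)) lowPath⊆central)
      where
      v∈T = spans v tv
      a = ancestor i v
      k = dep a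
      0<k : 1 ≤ k
      0<k = m<n*o⇒0<o 12 lower
      lowPath⊆central : lowPath a ⊆ central G T v
      lowPath⊆central = ancestorPath⊆central i v∈T (<⇒≤ i<dep)
        (12∣d∧d≤2k⇒5d<12[1+5[k/6]] k (12∣dep v tv) v≤2k) (≤-reflexive (1+5*[n/6]+lowWindow[n]≡1+n k)) upper

    chargeHigh : ∀ {ρ v i} → terminal v ≡ true → i < dep v →
      5 * dep v < 12 * dep (ancestor i v) → 2 * dep (ancestor i v) < dep v →
      isLeast ρ (pe (ancestor i v)) (central G T v) ≡ true →
      Σ (Fin n) λ c → chargedHigh ρ c ≡ true × highEdge c ≡ pe (ancestor i v)
    chargeHigh {ρ} {v} {i} tv i<dep lower 2k<v least =
      c , ∧-true (dep>0⇒candidate (≤-trans (s≤s z≤n) 2≤dep-c) (inVstar-ancestor i′ v∈T i′≤dep upper))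
                 (∧-true (T⇒≡true (≤⇒≤ᵇ 2≤dep-c))
                         (isLeast-⊆ {ρ} least′ (∈-ancestorPath⁺ c ≤-refl) highPath⊆central))
        , highEdge-c
      where
      v∈T = spans v tv
      k = dep (ancestor i v)
      q = k / 6
      0<k : 1 ≤ k
      0<k = m<n*o⇒0<o 12 lower
      k+i≡v : k + i ≡ dep v
      k+i≡v = dep-ancestor i v∈T (<⇒≤ i<dep)
      12[k+1+q]≤7v : 12 * (k + suc q) ≤ 7 * dep v
      12[k+1+q]≤7v = 12∣d∧2k<d⇒12[k+1+k/6]≤7d k (12∣dep v tv) 2k<v
      1+q≤i : suc q ≤ i
      1+q≤i = +-cancelˡ-≤ k (suc q) i (subst (k + suc q ≤_) (sym k+i≡v)
                (*-cancelˡ-≤ 12 (≤-trans 12[k+1+q]≤7v (*-monoˡ-≤ (dep v) (m≤m+n 7 5)))))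
      i′ = i ∸ suc q
      i′+1+q≡i : i′ + suc q ≡ i
      i′+1+q≡i = m∸n+n≡m 1+q≤i
      i′≤dep : i′ ≤ dep v
      i′≤dep = ≤-trans (m∸n≤m i (suc q)) (<⇒≤ i<dep)
      c = ancestor i′ v
      dep-c : dep c ≡ k + suc q
      dep-c = +-cancelʳ-≡ i′ _ _ (begin
        dep c + i′           ≡⟨ dep-ancestor i′ v∈T i′≤dep ⟩
        dep v                ≡⟨ k+i≡v ⟨
        k + i                ≡⟨ cong (k +_) (trans (sym i′+1+q≡i) (+-comm i′ (suc q))) ⟩
        k + (suc q + i′)     ≡⟨ +-assoc k (suc q) i′ ⟨
        k + suc q + i′       ∎)
        where open ≡-Reasoning
      upper : 12 * dep c ≤ 7 * dep v
      upper = subst (λ d → 12 * d ≤ 7 * dep v) (sym dep-c) 12[k+1+q]≤7v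
      2≤dep-c : 2 ≤ dep c
      2≤dep-c = subst (2 ≤_) (sym dep-c) (+-mono-≤ 0<k (s≤s z≤n))
      offset-c : highOffset (dep c) ≡ suc q
      offset-c = trans (cong highOffset dep-c) (highOffset[k+1+k/6]≡1+k/6 k)
      highEdge-c : highEdge c ≡ pe (ancestor i v)
      highEdge-c = begin
        pe (ancestor (highOffset (dep c)) c)  ≡⟨ cong (λ j → pe (ancestor j c)) offset-c ⟩
        pe (ancestor (suc q) c)               ≡⟨ cong pe (ancestor-+ (suc q) i′ v) ⟨
        pe (ancestor (suc q + i′) v)          ≡⟨ cong (λ j → pe (ancestor j v)) (trans (+-comm (suc q) i′) i′+1+q≡i) ⟩
        pe (ancestor i v)                     ∎
        where open ≡-Reasoning
      least′ : isLeast ρ (highEdge c) (central G T v) ≡ true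
      least′ = subst (λ e → isLeast ρ e (central G T v) ≡ true) (sym highEdge-c) least
      highPath⊆central : highPath c ⊆ central G T v
      highPath⊆central = ancestorPath⊆central i′ v∈T i′≤dep lower
        (≤-reflexive (trans (cong (λ o → k + suc o) offset-c) (trans (+-suc k (suc q)) (cong suc (sym dep-c))))) upper

    -- hubCount G T ρ is, by definition, the number of edges e with isHub ρ e.
    isHub : (Fin m → Fin m) → Fin m → Bool
    isHub ρ e = any (λ v → terminal v ∧ not (v == u) ∧ isLeast ρ e (central G T v)) (allFin n)

    chargedEdges : (Fin m → Fin m) → List (Fin m)
    chargedEdges ρ = map pe (filterᵇ (chargedLow ρ) (allFin n)) ++ map highEdge (filterᵇ (chargedHigh ρ) (allFin n))

    ∈-chargedEdges-low : ∀ {ρ x} → chargedLow ρ x ≡ true → pe x ∈ chargedEdges ρ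
    ∈-chargedEdges-low {ρ} {x} charged =
      ∈-++⁺ˡ (∈-map⁺ pe (∈-filter⁺ (T? ∘ chargedLow ρ) (∈-allFin x) (≡true⇒T charged)))

    ∈-chargedEdges-high : ∀ {ρ x} → chargedHigh ρ x ≡ true → highEdge x ∈ chargedEdges ρ
    ∈-chargedEdges-high {ρ} {x} charged =
      ∈-++⁺ʳ (map pe (filterᵇ (chargedLow ρ) (allFin n)))
             (∈-map⁺ highEdge (∈-filter⁺ (T? ∘ chargedHigh ρ) (∈-allFin x) (≡true⇒T charged)))

    leastCentral⇒∈-chargedEdges : ∀ {ρ v i} → terminal v ≡ true → i < dep v →
      5 * dep v < 12 * dep (ancestor i v) → 12 * dep (ancestor i v) ≤ 7 * dep v →
      isLeast ρ (pe (ancestor i v)) (central G T v) ≡ true → pe (ancestor i v) ∈ chargedEdges ρ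
    leastCentral⇒∈-chargedEdges {ρ} {v} {i} tv i<dep lower upper least with dep v ≤? 2 * dep (ancestor i v)
    ... | yes v≤2k = ∈-chargedEdges-low {ρ} (chargeLow {ρ} tv i<dep lower upper v≤2k least)
    ... | no  v≰2k = let c , charged , highEdge-c = chargeHigh {ρ} tv i<dep lower (≰⇒> v≰2k) least
                     in subst (_∈ chargedEdges ρ) highEdge-c (∈-chargedEdges-high {ρ} charged)

    isHub⇒∈-chargedEdges : ∀ {ρ e} → isHub ρ e ≡ true → e ∈ chargedEdges ρ
    isHub⇒∈-chargedEdges {ρ} {e} hub =
      let v , _ , hub-of-v = any-true⁻ _ (allFin n) hub
          least = ∧-trueʳ {not (v == u)} (∧-trueʳ {terminal v} hub-of-v)
          i , i<dep , lower , upper , e≡ = ∈-central⁻ v (isLeast⇒∈ {ρ} least)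
      in subst (_∈ chargedEdges ρ) (sym e≡)
           (leastCentral⇒∈-chargedEdges {ρ} (∧-trueˡ hub-of-v) i<dep lower upper
              (subst (λ e → isLeast ρ e (central G T v) ≡ true) e≡ least))

    hubCount≤ : ∀ ρ → hubCount G T ρ ≤ count (chargedLow ρ) (allFin n) + count (chargedHigh ρ) (allFin n)
    hubCount≤ ρ = begin
      length (filterᵇ (isHub ρ) (allFin m))
        ≤⟨ Unique-⊆⇒length≤ _ (chargedEdges ρ) (filter⁺ (T? ∘ isHub ρ) (allFin⁺ m)) hubs⊆chargedEdges ⟩
      length (map pe lows ++ map highEdge highs)
        ≡⟨ length-++ (map pe lows) ⟩
      length (map pe lows) + length (map highEdge highs)
        ≡⟨ cong₂ _+_ (length-map pe lows) (length-map highEdge highs) ⟩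
      length lows + length highs ∎
      where
      open ≤-Reasoning
      lows = filterᵇ (chargedLow ρ) (allFin n)
      highs = filterᵇ (chargedHigh ρ) (allFin n)
      hubs⊆chargedEdges : filterᵇ (isHub ρ) (allFin m) ⊆ chargedEdges ρ
      hubs⊆chargedEdges e∈ =
        isHub⇒∈-chargedEdges {ρ} (T⇒≡true (proj₂ (∈-filter⁻ (T? ∘ isHub ρ) {xs = allFin m} e∈)))

    weight : Fin n → ℕ
    weight x = count (λ ρ → chargedLow ρ x) (rankings G) + count (λ ρ → chargedHigh ρ x) (rankings G)

    sum-hubCount≤sum-weight : sum (map (hubCount G T) (rankings G)) ≤ sum (map weight (allFin n))
    sum-hubCount≤sum-weight = begin
      sum (map (hubCount G T) R)
        ≤⟨ sum-map-mono _ _ R (λ {ρ} _ → hubCount≤ ρ) ⟩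
      sum (map (λ ρ → count (chargedLow ρ) X + count (chargedHigh ρ) X) R)
        ≡⟨ sum-map-+ _ _ R ⟩
      sum (map (λ ρ → count (chargedLow ρ) X) R) + sum (map (λ ρ → count (chargedHigh ρ) X) R)
        ≡⟨ cong₂ _+_ (sum-count-swap chargedLow R X) (sum-count-swap chargedHigh R X) ⟩
      sum (map (λ x → count (λ ρ → chargedLow ρ x) R) X) + sum (map (λ x → count (λ ρ → chargedHigh ρ x) R) X)
        ≡⟨ sum-map-+ _ _ X ⟨
      sum (map weight X) ∎
      where
      open ≤-Reasoning
      R = rankings G
      X = allFin n

    weight≡0 : ∀ {x} → candidate x ≡ false → weight x ≡ 0
    weight≡0 {x} not-candidate = cong₂ _+_
      (count≡0 _ (rankings G) λ {ρ} _ → cong (_∧ isLeast ρ (pe x) (lowPath x)) not-candidate)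
      (count≡0 _ (rankings G) λ {ρ} _ → cong (_∧ ((2 ≤ᵇ dep x) ∧ isLeast ρ (highEdge x) (highPath x))) not-candidate)

    candidate⇒inT : ∀ {x} → candidate x ≡ true → inT x ≡ true
    candidate⇒inT {x} cand = ∧-trueˡ {inT x} (∧-trueˡ {inVstar G T x} cand)

    candidate⇒dep>0 : ∀ {x} → candidate x ≡ true → 1 ≤ dep x
    candidate⇒dep>0 {x} cand = ≢root⇒dep>0 (candidate⇒inT cand) x≢u
      where
      x≢u : x ≢ u
      x≢u refl = contradiction (trans (sym (cong not (==-refl x))) (∧-trueʳ {inVstar G T x} cand)) λ ()

    lowWindow*count-chargedLow≤#rankings : ∀ {x} → candidate x ≡ true →
      lowWindow (dep x) * count (λ ρ → chargedLow ρ x) (rankings G) ≤ length (rankings G)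
    lowWindow*count-chargedLow≤#rankings {x} cand = begin
      lowWindow (dep x) * count (λ ρ → chargedLow ρ x) (rankings G)
        ≡⟨ cong₂ _*_ (length-ancestorPath x (lowWindow (dep x)))
                     (sym (count-cong (λ ρ → cong (_∧ isLeast ρ (pe x) (lowPath x)) cand) (rankings G))) ⟨
      length (lowPath x) * count (λ ρ → isLeast ρ (pe x) (lowPath x)) (rankings G)
        ≤⟨ length*count-isLeast≤length-rankings (ancestorPath-unique (candidate⇒inT cand) (lowWindow[n]≤n (dep x)))
                                                (∈-ancestorPath⁺ x (lowWindow>0 (dep x) (candidate⇒dep>0 cand))) ⟩
      length (rankings G) ∎
      where open ≤-Reasoning

    highWindow*count-chargedHigh≤#rankings : ∀ {x} → candidate x ≡ true → 2 ≤ dep x →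
      suc (highOffset (dep x)) * count (λ ρ → chargedHigh ρ x) (rankings G) ≤ length (rankings G)
    highWindow*count-chargedHigh≤#rankings {x} cand 2≤dep = begin
      suc (highOffset (dep x)) * count (λ ρ → chargedHigh ρ x) (rankings G)
        ≡⟨ cong₂ _*_ (length-ancestorPath x (suc (highOffset (dep x)))) (sym (count-cong chargedHigh≗isLeast (rankings G))) ⟨
      length (highPath x) * count (λ ρ → isLeast ρ (highEdge x) (highPath x)) (rankings G)
        ≤⟨ length*count-isLeast≤length-rankings
             (ancestorPath-unique (candidate⇒inT cand) (2≤n⇒1+highOffset[n]≤n (dep x) 2≤dep))
                                                (∈-ancestorPath⁺ x ≤-refl) ⟩
      length (rankings G) ∎
      where
      open ≤-Reasoning
      chargedHigh≗isLeast : ∀ ρ → chargedHigh ρ x ≡ isLeast ρ (highEdge x) (highPath x)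
      chargedHigh≗isLeast ρ =
        cong₂ (λ a b → a ∧ (b ∧ isLeast ρ (highEdge x) (highPath x))) cand (T⇒≡true (≤⇒≤ᵇ 2≤dep))

    count-chargedHigh≡0 : ∀ {x} → dep x < 2 → count (λ ρ → chargedHigh ρ x) (rankings G) ≡ 0
    count-chargedHigh≡0 {x} dep<2 = count≡0 _ (rankings G) λ {ρ} _ →
      trans (cong (λ b → candidate x ∧ (b ∧ isLeast ρ (highEdge x) (highPath x))) 2≤ᵇdep≡false) (∧-zeroʳ (candidate x))
      where
      2≤ᵇdep≡false : (2 ≤ᵇ dep x) ≡ false
      2≤ᵇdep≡false with 2 ≤ᵇ dep x in 2≤ᵇdep
      ... | false = refl
      ... | true  = contradiction (≤ᵇ⇒≤ 2 (dep x) (≡true⇒T 2≤ᵇdep)) (<⇒≱ dep<2)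

    weight*dep≤16*#rankings : ∀ {x} → candidate x ≡ true → weight x * dep x ≤ 16 * length (rankings G)
    weight*dep≤16*#rankings {x} cand = begin
      weight x * dep x                 ≡⟨ *-distribʳ-+ (dep x) lows highs ⟩
      lows * dep x + highs * dep x     ≤⟨ +-mono-≤ lows*dep≤6N highs*dep≤7N ⟩
      6 * N + 7 * N                    ≡⟨ *-distribʳ-+ N 6 7 ⟨
      13 * N                           ≤⟨ *-monoˡ-≤ N (m≤m+n 13 3) ⟩
      16 * N                           ∎
      where
      open ≤-Reasoning
      N = length (rankings G)
      lows = count (λ ρ → chargedLow ρ x) (rankings G)
      highs = count (λ ρ → chargedHigh ρ x) (rankings G)
      lows*dep≤6N : lows * dep x ≤ 6 * N
      lows*dep≤6N = d≤c*L∧L*x≤N⇒x*d≤c*N 6 (lowWindow (dep x)) {x = lows} (n≤6*lowWindow[n] (dep x))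
                                          (lowWindow*count-chargedLow≤#rankings cand)
      highs*dep≤7N : highs * dep x ≤ 7 * N
      highs*dep≤7N with 2 ≤? dep x
      ... | yes 2≤dep = d≤c*L∧L*x≤N⇒x*d≤c*N 7 (suc (highOffset (dep x))) {x = highs} (n≤7*[1+highOffset[n]] (dep x))
                                              (highWindow*count-chargedHigh≤#rankings cand 2≤dep)
      ... | no  2≰dep rewrite count-chargedHigh≡0 {x} (≰⇒> 2≰dep) = z≤n

module Averaging (G : Graph) {r : Fin (Graph.n G)} (T : RootedTree G r) where

  open import Data.Nat using (_+_; _*_; _≤_; z≤n)
  import Data.Nat.Properties as ℕ
  open import Data.Integer as ℤ using (+_; +≤+)
  import Data.Integer.Properties as ℤ
  open import Data.Integer.Tactic.RingSolver using (solve-∀)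
  open import Data.Rational as ℚ using (ℚ; 0ℚ; _/_; toℚᵘ)
  open import Data.Rational.Properties as ℚ
    using (toℚᵘ-fromℚᵘ; toℚᵘ-injective; toℚᵘ-homo-+; toℚᵘ-homo-*; toℚᵘ-cancel-≤)
  open import Data.Rational.Unnormalised as ℚᵘ using (mkℚᵘ; *≡*; *≤*)
  import Data.Rational.Unnormalised.Properties as ℚᵘ

  Σℚ : List ℚ → ℚ
  Σℚ = foldr ℚ._+_ 0ℚ

  toℚᵘ-/ : ∀ a k → toℚᵘ (+ a / suc k) ℚᵘ.≃ mkℚᵘ (+ a) k
  toℚᵘ-/ a k = toℚᵘ-fromℚᵘ (mkℚᵘ (+ a) k)

  mkℚᵘ-≤ : ∀ a k b l → a * suc l ≤ b * suc k → mkℚᵘ (+ a) k ℚᵘ.≤ mkℚᵘ (+ b) l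
  mkℚᵘ-≤ a k b l h = *≤* (subst₂ ℤ._≤_ (sym (ℤ.+◃n≡+n (a * suc l))) (sym (ℤ.+◃n≡+n (b * suc k))) (+≤+ h))

  toℚᵘ-cancel-≤-≃ : ∀ {p q x y} → toℚᵘ p ℚᵘ.≃ x → toℚᵘ q ℚᵘ.≃ y → x ℚᵘ.≤ y → p ℚ.≤ q
  toℚᵘ-cancel-≤-≃ p≃x q≃y x≤y =
    toℚᵘ-cancel-≤ (ℚᵘ.≤-respʳ-≃ (ℚᵘ.≃-sym q≃y) (ℚᵘ.≤-respˡ-≃ (ℚᵘ.≃-sym p≃x) x≤y))

  ratio-0 : ∀ N → ratio G 0 N ≡ 0ℚ
  ratio-0 zero    = refl
  ratio-0 (suc k) = ℚ.0/n≡0 (suc k)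

  ratio-+ : ∀ a b N → ratio G (a + b) N ≡ ratio G a N ℚ.+ ratio G b N
  ratio-+ a b zero    = sym (ℚ.+-identityˡ 0ℚ)
  ratio-+ a b (suc k) = toℚᵘ-injective (ℚᵘ.≃-trans (toℚᵘ-/ (a + b) k) (ℚᵘ.≃-trans mkℚᵘ-+
    (ℚᵘ.≃-sym (ℚᵘ.≃-trans (toℚᵘ-homo-+ (+ a / suc k) (+ b / suc k)) (ℚᵘ.+-cong (toℚᵘ-/ a k) (toℚᵘ-/ b k))))))
    where
    [x+y]*[s*s]≡[x*s+y*s]*s : ∀ x y s → (x ℤ.+ y) ℤ.* (s ℤ.* s) ≡ (x ℤ.* s ℤ.+ y ℤ.* s) ℤ.* s
    [x+y]*[s*s]≡[x*s+y*s]*s = solve-∀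
    mkℚᵘ-+ : mkℚᵘ (+ (a + b)) k ℚᵘ.≃ mkℚᵘ (+ a) k ℚᵘ.+ mkℚᵘ (+ b) k
    mkℚᵘ-+ = *≡* (trans (cong₂ ℤ._*_ (ℤ.pos-+ a b) (sym (ℤ.+◃n≡+n (suc k * suc k))))
                        ([x+y]*[s*s]≡[x*s+y*s]*s (+ a) (+ b) (+ suc k)))

  ratio-mono : ∀ {a b} N → a ≤ b → ratio G a N ℚ.≤ ratio G b N
  ratio-mono zero    _   = ℚ.≤-refl
  ratio-mono {a} {b} (suc k) a≤b =
    toℚᵘ-cancel-≤-≃ (toℚᵘ-/ a k) (toℚᵘ-/ b k) (mkℚᵘ-≤ a k b k (ℕ.*-monoˡ-≤ (suc k) a≤b))

  ratio-sum : (w : A → ℕ) (xs : List A) (N : ℕ) → ratio G (sum (map w xs)) N ≡ Σℚ (map (λ x → ratio G (w x) N) xs)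
  ratio-sum w []       N = ratio-0 N
  ratio-sum w (x ∷ xs) N = trans (ratio-+ (w x) _ N) (cong (ratio G (w x) N ℚ.+_) (ratio-sum w xs N))

  Σℚ-mono : (f g : A → ℚ) → (∀ x → f x ℚ.≤ g x) → (xs : List A) → Σℚ (map f xs) ℚ.≤ Σℚ (map g xs)
  Σℚ-mono f g f≤g []       = ℚ.≤-refl
  Σℚ-mono f g f≤g (x ∷ xs) = ℚ.+-mono-≤ (f≤g x) (Σℚ-mono f g f≤g xs)

  Σℚ-*ˡ : (c : ℚ) (f : A → ℚ) (xs : List A) → Σℚ (map (λ x → c ℚ.* f x) xs) ≡ c ℚ.* Σℚ (map f xs)
  Σℚ-*ˡ c f []       = sym (ℚ.*-zeroʳ c)
  Σℚ-*ˡ c f (x ∷ xs) = trans (cong (c ℚ.* f x ℚ.+_) (Σℚ-*ˡ c f xs)) (sym (ℚ.*-distribˡ-+ c (f x) _))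

  toℚᵘ-16*inv : ∀ d → toℚᵘ ((+ 16 / 1) ℚ.* inv G T (suc d)) ℚᵘ.≃ mkℚᵘ (+ 16) d
  toℚᵘ-16*inv d = ℚᵘ.≃-trans (toℚᵘ-homo-* (+ 16 / 1) (+ 1 / suc d))
    (ℚᵘ.≃-trans (ℚᵘ.*-cong (toℚᵘ-/ 16 0) (toℚᵘ-/ 1 d))
    (*≡* (trans (cong (ℤ._* + suc d) (ℤ.*-identityʳ (+ 16))) (sym (cong (λ z → + 16 ℤ.* + suc z) (ℕ.+-identityʳ d))))))

  ratio≤16*inv : ∀ w d N → 1 ≤ d → w * d ≤ 16 * N → ratio G w N ℚ.≤ (+ 16 / 1) ℚ.* inv G T d
  ratio≤16*inv w (suc d) zero    _ _         = toℚᵘ-cancel-≤-≃ ℚᵘ.≃-refl (toℚᵘ-16*inv d) (mkℚᵘ-≤ 0 0 16 d z≤n)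
  ratio≤16*inv w (suc d) (suc k) _ w*d≤16*N =
    toℚᵘ-cancel-≤-≃ (toℚᵘ-/ w k) (toℚᵘ-16*inv d) (mkℚᵘ-≤ w k 16 d w*d≤16*N)

  ratio≤16*Σinv : (xs : List A) (H N : ℕ) (w : A → ℕ) (counted : A → Bool) (d : A → ℕ) →
    H ≤ sum (map w xs) → (∀ {x} → counted x ≡ false → w x ≡ 0) → (∀ {x} → counted x ≡ true → 1 ≤ d x) →
    (∀ {x} → counted x ≡ true → w x * d x ≤ 16 * N) →
    ratio G H N ℚ.≤ (+ 16 / 1) ℚ.* Σℚ (map (λ x → if counted x then inv G T (d x) else 0ℚ) xs)
  ratio≤16*Σinv xs H N w counted d H≤Σw w≡0 0<d w*d≤16N = begin
    ratio G H N                                                        ≤⟨ ratio-mono N H≤Σw ⟩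
    ratio G (sum (map w xs)) N                                         ≡⟨ ratio-sum w xs N ⟩
    Σℚ (map (λ x → ratio G (w x) N) xs)                                ≤⟨ Σℚ-mono _ _ ratio≤ xs ⟩
    Σℚ (map (λ x → (+ 16 / 1) ℚ.* (if counted x then inv G T (d x) else 0ℚ)) xs)
                                                                       ≡⟨ Σℚ-*ˡ (+ 16 / 1) _ xs ⟩
    (+ 16 / 1) ℚ.* Σℚ (map (λ x → if counted x then inv G T (d x) else 0ℚ) xs) ∎
    where
    open ℚ.≤-Reasoning
    ratio≤ : ∀ x → ratio G (w x) N ℚ.≤ (+ 16 / 1) ℚ.* (if counted x then inv G T (d x) else 0ℚ)
    ratio≤ x with counted x in cx
    ... | true  = ratio≤16*inv (w x) (d x) N (0<d cx) (w*d≤16N cx)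
    ... | false = ℚ.≤-reflexive (trans (cong (λ a → ratio G a N) (w≡0 cx)) (trans (ratio-0 N) (sym (ℚ.*-zeroʳ (+ 16 / 1)))))

open import Data.Nat.Divisibility using (_∣_)
open import Data.Integer using (+_)
open import Data.Rational using (_≤_; _*_; _/_)

mainTheorem14 : (G : Graph)
    → (T : (u : Fin (Graph.n G)) → Graph.terminal G u ≡ true → RootedTree G u)
    → (∀ v → Graph.terminal G v ≡ false → deg G v ≡ 2)
    → (∀ u v (hu : Graph.terminal G u ≡ true) (hv : Graph.terminal G v ≡ true)
         → pathE G (T u hu) v ≡ reverse (pathE G (T v hv) u))
    → (∀ u v w (hu : Graph.terminal G u ≡ true)
         → Graph.terminal G v ≡ true → Graph.terminal G w ≡ true
         → 12 ∣ treeDist G (T u hu) v w)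
    → ∀ u (hu : Graph.terminal G u ≡ true)
    → expectedHubs G (T u hu) ≤ (+ 16 / 1) * isk G (T u hu)
mainTheorem14 G T _ _ 12∣dist u hu =
  ratio≤16*Σinv (allFin (Graph.n G)) (sum (map (hubCount G Tu) (rankings G))) (length (rankings G))
                weight candidate (RootedTree.dep Tu)
                sum-hubCount≤sum-weight weight≡0 candidate⇒dep>0 weight*dep≤16*#rankings
  where
  Tu = T u hu
  12∣dep : ∀ v → Graph.terminal G v ≡ true → 12 ∣ RootedTree.dep Tu v
  12∣dep v tv = subst (12 ∣_) (HubCounting.TreePaths.treeDist-root G Tu v) (12∣dist u u v hu hu tv)
  open Averaging G Tu
  open HubCounting.Charging G u Tu 12∣dep
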